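{- For every query $R$, the rewriting system $\mathcal{R}^{\mathrm{query}}(R)$ is terminating, i.e. admits no infinite sequence of one-step rewrites.
   Context: Setting. $\Sigma$ is an order-sorted algebraic signature with sorts $\mathsf{Fact}$ and $\mathsf{Bool}$, $\mathcal{D}$ a $\Sigma$-algebra of facts presented by equational attributes $A$ (associativity, commutativity, identity) and directed equations confluent and terminating modulo $A$, defining Boolean connectives and Boolean equality on every sort; every ground $\mathsf{Bool}$ term reduces to $\mathit{true}$ or $\mathit{false}$. Terms are fully reduced, compared modulo $A$. Finite multisets of facts use an associative-commutative union $\circ$ with identity $\emptyset$. Patterns: AC $\circ$-combinations of blocks $[F]_!$, $[F]_?$ ($F$ non-empty multiset of possibly non-ground facts), with $[F_1]_m\circ[F_2]_m=[F_1\circ F_2]_m$; $P_!,P_?$ are the multisets of facts in the respective blocks. Terminating-and-preserving: only $!$- and $?$-blocks and $P_?\ne\emptyset$. Conditions: $\mathsf{False}$; $\{B\}$ ($B$ a $\mathsf{Bool}$ term); $\neg\psi$; $\psi_1\vee\psi_2$; $\exists P.\psi$ ($P$ terminating-and-preserving), the quantifier binding in $\psi$ the variables of $P$ not bound by the context. Condition rewriting on stacks $T$ of condition frames $\mathsf{Res}(B)$, $\mathsf{Not}$, $[\vec a]^{\vec v}_\psi$, $[\vec a]^{\vec v,\downarrow}_\psi$, $[G\mid\vec a]^{\vec v}_{\exists P.\psi}$ (with $\sigma=\{\vec a/\vec v\}$) over a database $F$, where "$X\mapsto Y$" replaces the top segment $X$ of $T$ by $Y$: (1) $[\vec a]^{\vec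 v}_{\mathsf{False}}\mapsto\mathsf{Res}(\mathit{false})$, $[\vec a]^{\vec v}_{\{B\}}\mapsto\mathsf{Res}(\sigma(B))$; (2) $[\vec a]^{\vec v}_{\neg\psi}\mapsto\mathsf{Not}[\vec a]^{\vec v}_\psi$, $\mathsf{Not}\,\mathsf{Res}(B)\mapsto\mathsf{Res}(\neg B)$; (3) $[\vec a]^{\vec v}_{\psi_1\vee\psi_2}\mapsto[\vec a]^{\vec v,\downarrow}_{\psi_1}[\vec a]^{\vec v}_{\psi_2}$, $[\vec a]^{\vec v,\downarrow}_\psi\mathsf{Res}(\mathit{true})\mapsto\mathsf{Res}(\mathit{true})$, $[\vec a]^{\vec v,\downarrow}_\psi\mathsf{Res}(\mathit{false})\mapsto[\vec a]^{\vec v}_\psi$; (4) $[\vec a]^{\vec v}_{\exists P.\psi}\mapsto[F\mid\vec a]^{\vec v}_{\exists P.\psi}$; (5) with $\vec w$ the variables of $P$ not in $\vec v$, if $G=G'\circ\sigma'(P_!\circ P_?)$ for $\sigma'=\{\vec a/\vec v,\vec b/\vec w\}$, then $[G\mid\vec a]^{\vec v}_{\exists P.\psi}\mapsto[G'\circ\sigma'(P_!)\mid\vec a]^{\vec v}_{\exists P.\psi}[\vec a,\vec b]^{\vec v,\vec w}_\psi$; (6) $[G\mid\vec a]_{\exists P.\psi}\mathsf{Res}(\mathit{false})\mapsto[G\mid\vec a]_{\exists P.\psi}$, $[G\mid\vec a]_{\exists P.\psi}\mathsf{Res}(\mathit{true})\mapsto\mathsf{Res}(\mathit{true})$; (7)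 if no decomposition as in (5) exists, $[G\mid\vec a]^{\vec v}_{\exists P.\psi}\mapsto\mathsf{Res}(\mathit{false})$. Queries: $\emptyset$; any fact $f$ (possibly with variables); $Q_1\oplus Q_2$; $\varphi\Rightarrow Q$ ($\varphi$ a condition); $\mathsf{From}\,P.\,Q$ with $P$ terminating-and-preserving, binding in $Q$ the variables of $P$ not bound by the context. Rewriting system $\mathcal{R}^{\mathrm{query}}(Q)$: states $\{F,F',S\}^q$ ($F$ database, $F'$ partial answer, $S$ a stack, top at right) or $\mathsf{Ans}(F')$. Frames: $[\vec a]^{\vec v}_R$; $[\vec a\mid T]^{\vec v}_R$ ($T$ a condition stack); $[G\mid\vec a]^{\vec v}_{\mathsf{From}\,P.R}$, with $R$ a subquery, $\vec v$ distinct variables covering its free variables, $\sigma=\{\vec a/\vec v\}$. Rules: $\{F,F',S[\vec a]^{\vec v}_f\}^q\to\{F,F'\circ\sigma(f),S\}^q$; $\{F,F',S[\vec a]^{\vec v}_\emptyset\}^q\to\{F,F',S\}^q$; $\{F,F',S[\vec a]^{\vec v}_{R_1\oplus R_2}\}^q\to\{F,F',S[\vec a]^{\vec v}_{R_2}[\vec a]^{\vec v}_{R_1}\}^q$; $\{F,F',S[\vec a]^{\vec v}_{\varphi\Rightarrow R}\}^q\to\{F,F',S[\vec a\mid[\vec a]^{\vec v}_\varphi]^{\vec v}_R\}^q$; $\{F,F',S[\vec a\mid T]_R\}^q\to\{F,F',S[\vec a\mid T']_R\}^q$ whenever $T$ rewrites to $T'$ by a condition rule (1)–(7) over database $F$;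 $\{F,F',S[\vec a\mid\mathsf{Res}(\mathit{false})]_R\}^q\to\{F,F',S\}^q$; $\{F,F',S[\vec a\mid\mathsf{Res}(\mathit{true})]^{\vec v}_R\}^q\to\{F,F',S[\vec a]^{\vec v}_R\}^q$; $\{F,F',S[\vec a]^{\vec v}_{\mathsf{From}\,P.R}\}^q\to\{F,F',S[F\mid\vec a]^{\vec v}_{\mathsf{From}\,P.R}\}^q$; if $G=G'\circ\sigma'(P_!\circ P_?)$ with $\sigma'=\{\vec a/\vec v,\vec b/\vec w\}$ ($\vec w$ the variables of $P$ not in $\vec v$) then $\{F,F',S[G\mid\vec a]_{\mathsf{From}\,P.R}\}^q\to\{F,F',S[G'\circ\sigma'(P_!)\mid\vec a]_{\mathsf{From}\,P.R}[\vec a,\vec b]^{\vec v,\vec w}_R\}^q$; if no such decomposition exists, $\{F,F',S[G\mid\vec a]_{\mathsf{From}\,P.R}\}^q\to\{F,F',S\}^q$; $\{F,F',\text{empty stack}\}^q\to\mathsf{Ans}(F')$. Matching is modulo $A$ and the equations. -}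

module Defs where

open import Data.Bool using (Bool; true; false; not)
open import Data.Nat using (ℕ; suc)
open import Data.List using (List; []; _∷_; _++_; map; filter; concatMap; deduplicate; length)
open import Data.List.NonEmpty using (List⁺; toList)
open import Data.Product using (Σ; _×_; ∃)
open import Relation.Binary using (Setoid; DecidableEquality)
open import Relation.Binary.PropositionalEquality using (_≡_)
open import Relation.Nullary using (¬_)
open import Relation.Nullary.Decidable using (¬?)

-- Var     : variables (decidable equality)
--   Val     : ground (fully reduced) terms, the values variables are bound to
--   FactPat : Fact-sorted terms, possibly containing variables
--   BoolTm  : Bool-sorted terms, possibly containing variables
--   FactS   : ground fully reduced facts, with equality modulo the attributes A
--   substF vs as f : the normal form of {as/vs}(f)
--   evalB  vs as B : the normal form (true or false) of {as/vs}(B)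
--     (every ground Bool term reduces to true or false)
record FactAlgebra : Set₁ where
  field
    Var     : Set
    _≟V_    : DecidableEquality Var
    Val     : Set
    FactPat : Set
    BoolTm  : Set
    varsF   : FactPat → List Var
    FactS   : Setoid _ _
    substF  : List Var → List Val → FactPat → Setoid.Carrier FactS
    evalB   : List Var → List Val → BoolTm → Bool

module System (Th : FactAlgebra) where
  open FactAlgebra Th
  open import Data.List.Membership.DecPropositional _≟V_ using (_∈?_)
  open import Data.List.Relation.Binary.Permutation.Setoid FactS using (_↭_)

  Fact : Set
  Fact = Setoid.Carrier FactS

  -- finite multisets of facts: lists, compared up to permutation modulo A
  DB : Set
  DB = List Fact

  record Pat : Set where
    constructor pat
    field
      bang  : List FactPat
      quest : List⁺ FactPat
  open Pat public

  patFacts : Pat → List FactPat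
  patFacts P = bang P ++ toList (quest P)

  freshVars : List Var → Pat → List Var
  freshVars vs P =
    deduplicate _≟V_ (filter (λ x → ¬? (x ∈? vs)) (concatMap varsF (patFacts P)))

  Decomp : DB → List Var → List Val → Pat → DB → List Val → Set
  Decomp G vs as P G' bs =
    length bs ≡ length (freshVars vs P) ×
    (G ↭ (G' ++ map (substF (vs ++ freshVars vs P) (as ++ bs)) (patFacts P)))

  remain : List Var → List Val → Pat → DB → List Val → DB
  remain vs as P G' bs = G' ++ map (substF (vs ++ freshVars vs P) (as ++ bs)) (bang P)

  data Cond : Set where
    False : Cond
    atom  : BoolTm → Cond
    ¬c_   : Cond → Cond
    _∨c_  : Cond → Cond → Cond
    ∃c    : Pat → Cond → Cond

  data Query : Set where
    ∅q    : Query
    fact  : FactPat → Query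
    _⊕_   : Query → Query → Query
    _⇒_   : Cond → Query → Query
    From  : Pat → Query → Query

  -- condition frames; vs are the variables, as the values (σ = {as/vs})
  data CFrame : Set where
    Res  : Bool → CFrame
    Not  : CFrame
    cnd  : List Var → List Val → Cond → CFrame
    cndD : List Var → List Val → Cond → CFrame
    cex  : DB → List Var → List Val → Pat → Cond → CFrame

  -- condition stacks: the TOP of the stack is the HEAD of the list
  CStack : Set
  CStack = List CFrame

  data CStep (F : DB) : CStack → CStack → Set where
    r-false : ∀ {vs as T} → CStep F (cnd vs as False ∷ T) (Res false ∷ T)
    r-atom  : ∀ {vs as B T} → CStep F (cnd vs as (atom B) ∷ T) (Res (evalB vs as B) ∷ T)
    r-neg   : ∀ {vs as ψ T} → CStep F (cnd vs as (¬c ψ) ∷ T) (cnd vs as ψ ∷ Not ∷ T)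
    r-not   : ∀ {b T} → CStep F (Res b ∷ Not ∷ T) (Res (not b) ∷ T)
    r-or    : ∀ {vs as ψ₁ ψ₂ T} →
              CStep F (cnd vs as (ψ₁ ∨c ψ₂) ∷ T) (cnd vs as ψ₂ ∷ cndD vs as ψ₁ ∷ T)
    r-orT   : ∀ {vs as ψ T} → CStep F (Res true ∷ cndD vs as ψ ∷ T) (Res true ∷ T)
    r-orF   : ∀ {vs as ψ T} → CStep F (Res false ∷ cndD vs as ψ ∷ T) (cnd vs as ψ ∷ T)
    r-ex    : ∀ {vs as P ψ T} → CStep F (cnd vs as (∃c P ψ) ∷ T) (cex F vs as P ψ ∷ T)
    r-match : ∀ {G vs as P ψ T} G' bs → Decomp G vs as P G' bs →
              CStep F (cex G vs as P ψ ∷ T)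
                      (cnd (vs ++ freshVars vs P) (as ++ bs) ψ
                        ∷ cex (remain vs as P G' bs) vs as P ψ ∷ T)
    r-exF   : ∀ {G vs as P ψ T} → CStep F (Res false ∷ cex G vs as P ψ ∷ T) (cex G vs as P ψ ∷ T)
    r-exT   : ∀ {G vs as P ψ T} → CStep F (Res true ∷ cex G vs as P ψ ∷ T) (Res true ∷ T)
    r-nomatch : ∀ {G vs as P ψ T} → ¬ (Σ DB λ G' → Σ (List Val) λ bs → Decomp G vs as P G' bs) →
              CStep F (cex G vs as P ψ ∷ T) (Res false ∷ T)

  data QFrame : Set where
    qf    : List Var → List Val → Query → QFrame
    qc    : List Var → List Val → CStack → Query → QFrame
    qfrom : DB → List Var → List Val → Pat → Query → QFrame

  -- states {F, F', S}^q (top of S = head of list) and Ans(F')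
  data State : Set where
    st  : DB → DB → List QFrame → State
    ans : DB → State

  -- one-step rewriting of R^query(R); the rules are uniform in R
  data QStep (R : Query) : State → State → Set where
    q-fact  : ∀ {F F' vs as f S} → QStep R (st F F' (qf vs as (fact f) ∷ S)) (st F (F' ++ (substF vs as f ∷ [])) S)
    q-empty : ∀ {F F' vs as S} → QStep R (st F F' (qf vs as ∅q ∷ S)) (st F F' S)
    q-plus  : ∀ {F F' vs as R₁ R₂ S} →
              QStep R (st F F' (qf vs as (R₁ ⊕ R₂) ∷ S)) (st F F' (qf vs as R₁ ∷ qf vs as R₂ ∷ S))
    q-impl  : ∀ {F F' vs as φ R' S} →
              QStep R (st F F' (qf vs as (φ ⇒ R') ∷ S)) (st F F' (qc vs as (cnd vs as φ ∷ []) R' ∷ S))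
    q-cond  : ∀ {F F' vs as T T' R' S} → CStep F T T' →
              QStep R (st F F' (qc vs as T R' ∷ S)) (st F F' (qc vs as T' R' ∷ S))
    q-condF : ∀ {F F' vs as R' S} →
              QStep R (st F F' (qc vs as (Res false ∷ []) R' ∷ S)) (st F F' S)
    q-condT : ∀ {F F' vs as R' S} →
              QStep R (st F F' (qc vs as (Res true ∷ []) R' ∷ S)) (st F F' (qf vs as R' ∷ S))
    q-from  : ∀ {F F' vs as P R' S} →
              QStep R (st F F' (qf vs as (From P R') ∷ S)) (st F F' (qfrom F vs as P R' ∷ S))
    q-match : ∀ {F F' G vs as P R' S} G' bs → Decomp G vs as P G' bs →
              QStep R (st F F' (qfrom G vs as P R' ∷ S))
                      (st F F' (qf (vs ++ freshVars vs P) (as ++ bs) R'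
                                 ∷ qfrom (remain vs as P G' bs) vs as P R' ∷ S))
    q-nomatch : ∀ {F F' G vs as P R' S} →
              ¬ (Σ DB λ G' → Σ (List Val) λ bs → Decomp G vs as P G' bs) →
              QStep R (st F F' (qfrom G vs as P R' ∷ S)) (st F F' S)
    q-done  : ∀ {F F'} → QStep R (st F F' []) (ans F')

  Terminating : Query → Set
  Terminating R = ¬ (Σ (ℕ → State) λ s → ∀ n → QStep R (s n) (s (suc n)))

-- Every rule strictly decreases a natural-number weight of the state. The database F of a
-- state never changes, so a frame [G | a]_{∃P.ψ} or [G | a]_{From P.R} can be weighted
-- (|G| + 1) · w, with w exceeding the weight of the subframe it spawns: a match removes at
-- least one ?-fact from G, and the resulting drop of w pays for that subframe. Conditions
-- and queries are then weighted structurally, charging ∃ and From for the worst case G = F.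
module Submission where

open import Defs
open import Data.Nat
open import Data.Nat.Induction using (<-wellFounded)
open import Data.Nat.Properties
open import Data.List using (List; []; _∷_; _++_; map; length)
open import Data.List.NonEmpty using (_∷_)
open import Data.List.Properties using (map-++; ++-assoc)
open import Data.Product using (_,_)
open import Function using (_∘_)
open import Induction.InfiniteDescent using (InfiniteDescendingSequence)
open import Induction.WellFounded using (WellFounded; Acc; acc)
open import Relation.Binary using (Rel)
open import Relation.Binary.PropositionalEquality using (cong)
open import Relation.Nullary using (¬_)

wellFounded⇒¬infiniteDescent : ∀ {a r} {A : Set a} {_<_ : Rel A r} → WellFounded _<_ →
                               (f : ℕ → A) → ¬ InfiniteDescendingSequence _<_ f
wellFounded⇒¬infiniteDescent {_<_ = _<_} wf f = go f (wf (f 0))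
  where
  go : ∀ g → Acc _<_ (g 0) → ¬ InfiniteDescendingSequence _<_ g
  go g (acc rs) desc = go (g ∘ suc) (rs (desc 0)) (desc ∘ suc)

length-<-++-∷ : ∀ {a} {A : Set a} (xs : List A) {y ys} → length xs < length (xs ++ y ∷ ys)
length-<-++-∷ []       = s≤s z≤n
length-<-++-∷ (_ ∷ xs) = s≤s (length-<-++-∷ xs)

m+n<o⇒m+[n+t]<o+t : ∀ m n {o t} → m + n < o → m + (n + t) < o + t
m+n<o⇒m+[n+t]<o+t m n {o} {t} m+n<o = begin-strict
  m + (n + t) ≡⟨ +-assoc m n t ⟨
  m + n + t   <⟨ +-monoˡ-< t m+n<o ⟩
  o + t       ∎
  where open ≤-Reasoning

m<k⇒r<g⇒m+[1+r]*k<[1+g]*k : ∀ {m k r g} → m < k → r < g → m + suc r * k < suc g * k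
m<k⇒r<g⇒m+[1+r]*k<[1+g]*k {m} {k} {r} {g} m<k r<g = begin-strict
  m + suc r * k     <⟨ +-monoˡ-< (suc r * k) m<k ⟩
  suc (suc r) * k   ≤⟨ *-monoˡ-≤ k (s≤s r<g) ⟩
  suc g * k         ∎
  where open ≤-Reasoning

module Weights (Th : FactAlgebra) where
  open FactAlgebra Th
  open System Th
  open import Data.List.Relation.Binary.Permutation.Setoid.Properties FactS
    using (xs↭ys⇒|xs|≡|ys|)

  remain-shorter : ∀ G vs as P G' bs → Decomp G vs as P G' bs →
                   length (remain vs as P G' bs) < length G
  remain-shorter G vs as P@(pat bang (q ∷ qs)) G' bs (_ , G↭) = begin-strict
    length (G' ++ map σ bang)                         <⟨ length-<-++-∷ (G' ++ map σ bang) ⟩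
    length ((G' ++ map σ bang) ++ σ q ∷ map σ qs)     ≡⟨ cong length (++-assoc G' _ _) ⟩
    length (G' ++ map σ bang ++ map σ (q ∷ qs))       ≡⟨ cong (length ∘ (G' ++_)) (map-++ σ bang (q ∷ qs)) ⟨
    length (G' ++ map σ (patFacts P))                 ≡⟨ xs↭ys⇒|xs|≡|ys| G↭ ⟨
    length G                                          ∎
    where
    open ≤-Reasoning
    σ : FactPat → Fact
    σ = substF (vs ++ freshVars vs P) (as ++ bs)

  -- A compound condition or query weighs one more than the frames it is rewritten into.
  module _ (F : DB) where
    condWeight : Cond → ℕ
    condWeight False      = 2
    condWeight (atom _)   = 2
    condWeight (¬c ψ)     = condWeight ψ + 2
    condWeight (ψ₁ ∨c ψ₂) = suc (condWeight ψ₂ + suc (condWeight ψ₁))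
    condWeight (∃c _ ψ)   = suc (suc (length F) * (2 + condWeight ψ))

    cframeWeight : CFrame → ℕ
    cframeWeight (Res _)          = 1
    cframeWeight Not              = 1
    cframeWeight (cnd _ _ ψ)      = condWeight ψ
    cframeWeight (cndD _ _ ψ)     = suc (condWeight ψ)
    cframeWeight (cex G _ _ _ ψ)  = suc (length G) * (2 + condWeight ψ)

    cstackWeight : CStack → ℕ
    cstackWeight []      = 0
    cstackWeight (x ∷ T) = cframeWeight x + cstackWeight T

    queryWeight : Query → ℕ
    queryWeight ∅q         = 1
    queryWeight (fact _)   = 1
    queryWeight (R₁ ⊕ R₂)  = suc (queryWeight R₁ + queryWeight R₂)
    queryWeight (φ ⇒ R)    = suc (suc (condWeight φ + queryWeight R))
    queryWeight (From _ R) = suc (suc (length F) * suc (queryWeight R))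

    qframeWeight : QFrame → ℕ
    qframeWeight (qf _ _ R)          = queryWeight R
    qframeWeight (qc _ _ T R)        = suc (cstackWeight T + queryWeight R)
    qframeWeight (qfrom G _ _ _ R)   = suc (length G) * suc (queryWeight R)

    qstackWeight : List QFrame → ℕ
    qstackWeight []      = 0
    qstackWeight (x ∷ S) = qframeWeight x + qstackWeight S

  stateWeight : State → ℕ
  stateWeight (st F _ S) = suc (qstackWeight F S)
  stateWeight (ans _)    = 0

  cstackWeight-decreasing : ∀ {F T T'} → CStep F T T' → cstackWeight F T' < cstackWeight F T
  cstackWeight-decreasing r-false = n<1+n _
  cstackWeight-decreasing r-atom  = n<1+n _
  cstackWeight-decreasing {F} (r-neg {ψ = ψ}) =
    m+n<o⇒m+[n+t]<o+t (condWeight F ψ) 1 (+-monoʳ-< (condWeight F ψ) (n<1+n 1))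
  cstackWeight-decreasing r-not = n<1+n _
  cstackWeight-decreasing {F} (r-or {ψ₁ = ψ₁} {ψ₂}) =
    m+n<o⇒m+[n+t]<o+t (condWeight F ψ₂) (suc (condWeight F ψ₁)) (n<1+n _)
  cstackWeight-decreasing r-orT = s≤s (s≤s (m≤n+m _ _))
  cstackWeight-decreasing r-orF = s≤s (n≤1+n _)
  cstackWeight-decreasing r-ex  = n<1+n _
  cstackWeight-decreasing {F} (r-match {G} {vs} {as} {P} {ψ} G' bs decomp) =
    m+n<o⇒m+[n+t]<o+t (condWeight F ψ) (cframeWeight F (cex (remain vs as P G' bs) vs as P ψ))
      (m<k⇒r<g⇒m+[1+r]*k<[1+g]*k (m<n+m _ (s≤s z≤n)) (remain-shorter G vs as P G' bs decomp))
  cstackWeight-decreasing r-exF         = n<1+n _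
  cstackWeight-decreasing r-exT         = s≤s (s≤s (m≤n+m _ _))
  cstackWeight-decreasing (r-nomatch _) = s≤s (s≤s (m≤n+m _ _))

  qstackWeight-decreasing : ∀ {R F F' G G' S S'} → QStep R (st F F' S) (st G G' S') →
                            qstackWeight G S' < qstackWeight F S
  qstackWeight-decreasing q-fact  = n<1+n _
  qstackWeight-decreasing q-empty = n<1+n _
  qstackWeight-decreasing {F = F} (q-plus {R₁ = R₁} {R₂}) =
    m+n<o⇒m+[n+t]<o+t (queryWeight F R₁) (queryWeight F R₂) (n<1+n _)
  qstackWeight-decreasing {F = F} (q-impl {φ = φ} {R'}) =
    +-monoˡ-< _ (s≤s (s≤s (≤-reflexive (cong (_+ queryWeight F R') (+-identityʳ (condWeight F φ))))))
  qstackWeight-decreasing (q-cond T→T') = +-monoˡ-< _ (s≤s (+-monoˡ-< _ (cstackWeight-decreasing T→T')))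
  qstackWeight-decreasing q-condF = s≤s (m≤n+m _ _)
  qstackWeight-decreasing {F = F} (q-condT {R' = R'}) = +-monoˡ-< _ (m<n⇒m<1+n (n<1+n (queryWeight F R')))
  qstackWeight-decreasing q-from  = n<1+n _
  qstackWeight-decreasing {F = F} (q-match {G = G} {vs} {as} {P} {R'} G' bs decomp) =
    m+n<o⇒m+[n+t]<o+t (queryWeight F R') (qframeWeight F (qfrom (remain vs as P G' bs) vs as P R'))
      (m<k⇒r<g⇒m+[1+r]*k<[1+g]*k (n<1+n _) (remain-shorter G vs as P G' bs decomp))
  qstackWeight-decreasing (q-nomatch _) = s≤s (m≤n+m _ _)

  stateWeight-decreasing : ∀ {R s s'} → QStep R s s' → stateWeight s' < stateWeight s
  stateWeight-decreasing {s = st _ _ _} {st _ _ _} step = s≤s (qstackWeight-decreasing step)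
  stateWeight-decreasing {s = st _ _ _} {ans _} q-done = s≤s z≤n
  stateWeight-decreasing {s = ans _} ()

theorem28 : (Th : FactAlgebra) (R : System.Query Th) → System.Terminating Th R
theorem28 Th R (s , steps) =
  wellFounded⇒¬infiniteDescent <-wellFounded (stateWeight ∘ s) (stateWeight-decreasing ∘ steps)
  where open Weights Th
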